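{- Let $T$ be a tree on $2$. Let $R_T$ be the symmetrization (closure under cyclic permutations and inverses) of the set of defining relators of $G_T$. Then $R_T$ satisfies the small cancellation condition $C'(1/8)$.
   Context: A tree on $2=\{0,1\}$ is a nonempty subset of $2^{<\mathbb{N}}$ closed under initial segments. Let $\mathbb{F}_2=\langle x,y\rangle$ and define endomorphisms $f_0,f_1$ of $\mathbb{F}_2$ by $f_0(x)=x^5y$, $f_0(y)=y^5x$, $f_1(x)=x^2yxyx$, $f_1(y)=y^2xyxy$. Let $f_e$ be the identity and for $w=w_1\cdots w_n\in 2^{<\mathbb{N}}$ let $f_w=f_{w_1}\circ\cdots\circ f_{w_n}$. For a tree $T$, $G_T$ is the group with generators $x,y$ and relators $f_w(x)^{59}, f_w(y)^{61}$ for all $w\in T$ and $f_w(x)^{67}, f_w(y)^{71}$ for all $w\in 2^{<\mathbb{N}}\setminus T$. A symmetrized set $R$ of cyclically reduced words satisfies $C'(\lambda)$ if whenever $r\in R$ is written (reduced) as $r=bc$ where $b$ is a piece, i.e. $b$ is also an initial segment of some $r'\in R$ with $r'\neq r$, then $|b|<\lambda|r|$. -}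

module Defs where

open import Data.Bool using (Bool; true; false; not)
open import Data.Nat using (ℕ; zero; suc; _*_; _<_)
open import Data.List using (List; []; _∷_; _++_; reverse; map; concatMap; length)
open import Data.Product using (Σ; _×_; _,_; ∃)
open import Data.Sum using (_⊎_)
open import Relation.Nullary using (¬_)
open import Relation.Binary.PropositionalEquality using (_≡_)

data Gen : Set where
  gx gy : Gen

-- A letter is a generator together with an exponent sign:
-- (g , false) stands for g, (g , true) stands for g⁻¹.
Letter : Set
Letter = Gen × Bool

-- Words in the free group (not necessarily reduced)
Word : Set
Word = List Letter

x y : Letter
x = (gx , false)
y = (gy , false)

invL : Letter → Letter
invL (g , s) = (g , not s)

invW : Word → Word
invW w = reverse (map invL w)

cancels : Letter → Letter → Bool
cancels (gx , s) (gx , t) = xorB s t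
  where
  xorB : Bool → Bool → Bool
  xorB false b = b
  xorB true b = not b
cancels (gy , s) (gy , t) = xorB s t
  where
  xorB : Bool → Bool → Bool
  xorB false b = b
  xorB true b = not b
cancels _ _ = false

push : Letter → Word → Word
push a [] = a ∷ []
push a (b ∷ w) with cancels a b
... | true  = w
... | false = a ∷ b ∷ w

reduce : Word → Word
reduce [] = []
reduce (a ∷ w) = push a (reduce w)

pow : Word → ℕ → Word
pow w zero = []
pow w (suc n) = reduce (w ++ pow w n)

xs : ℕ → Letter → Word
xs zero a = []
xs (suc n) a = a ∷ xs n a

-- images of the generators under f₀ (false) and f₁ (true)
img : Bool → Gen → Word
img false gx = xs 5 x ++ y ∷ []
img false gy = xs 5 y ++ x ∷ []
img true  gx = x ∷ x ∷ y ∷ x ∷ y ∷ x ∷ []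
img true  gy = y ∷ y ∷ x ∷ y ∷ x ∷ y ∷ []

imgL : Bool → Letter → Word
imgL b (g , false) = img b g
imgL b (g , true)  = invW (img b g)

f : Bool → Word → Word
f b w = reduce (concatMap (imgL b) w)

fw : List Bool → Word → Word
fw [] u = u
fw (b ∷ w) u = f b (fw w u)

record Tree : Set₁ where
  field
    mem      : List Bool → Set
    nonempty : ∃ λ w → mem w
    closed   : ∀ u v → mem (u ++ v) → mem u
open Tree public

IsRelator : Tree → Word → Set
IsRelator T r = Σ (List Bool) λ w →
    (mem T w × r ≡ pow (fw w (x ∷ [])) 59)
  ⊎ (mem T w × r ≡ pow (fw w (y ∷ [])) 61)
  ⊎ (¬ mem T w × r ≡ pow (fw w (x ∷ [])) 67)
  ⊎ (¬ mem T w × r ≡ pow (fw w (y ∷ [])) 71)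

Symmetrization : (Word → Set) → Word → Set
Symmetrization R r = Σ Word λ ρ → R ρ × Σ Word λ u → Σ Word λ v →
  ρ ≡ u ++ v × (r ≡ v ++ u ⊎ r ≡ invW (v ++ u))

RT : Tree → Word → Set
RT T = Symmetrization (IsRelator T)

-- C'(1/k) : every piece b occurring as r = b c
-- satisfies |b| < |r| / k, i.e. k·|b| < |r|.
C′-inv : ℕ → (Word → Set) → Set
C′-inv k R = ∀ r r′ → R r → R r′ → ¬ r ≡ r′ →
  ∀ b c d → r ≡ b ++ c → r′ ≡ b ++ d → k * length b < length r

-- Each f_w(g) is a positive word, so f_w(g)^n is freely reduced and is a segment of the
-- 6^|w|-periodic letter sequence of f_w(g)^∞; every element of R_T is a cyclic shift of such a
-- word or of its inverse, and a positive and a negative word have no common nonempty prefix.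
-- The substitutions f₀, f₁ are recognizable: any seven consecutive letters of f_b(u) determine b
-- and the position modulo 6 and are never constant, while the last letter of each block of six
-- determines the letter of u it replaced.  By induction on |w|, two such sequences sharing a
-- subword of length 7·6^|w| have the same w and g, hence the same exponent, and then by
-- periodicity the two relators coincide.  Since every exponent is at least 59 > 8·7, a piece of
-- length at least |r|/8 would be that long.

module Submission where

open import Defs
open import Data.Bool using (Bool; true; false; not)
open import Data.Bool.Properties using () renaming (_≟_ to _≟ᴮ_)
open import Data.Empty using (⊥-elim)
open import Data.Fin using (Fin; toℕ)
open import Data.Fin.Patterns using (0F; 1F; 2F; 3F; 4F; 5F)
open import Data.Fin.Properties using (all?; toℕ-fromℕ<) renaming (_≟_ to _≟ᶠ_)
open import Data.List using (List; []; _∷_; _++_; length; map; reverse; concatMap)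
open import Data.List.Membership.Propositional using (_∈_)
open import Data.List.Membership.Propositional.Properties using (∈-map⁻)
open import Data.List.Properties
  using (∷-injective; ++-identityʳ; length-map; length-reverse; map-++; reverse-++)
  renaming (≡-dec to ≡-decᴸ)
open import Data.List.Relation.Unary.Any using (here; there)
import Data.List.Relation.Unary.Any.Properties as Any
open import Data.Nat
  using (ℕ; zero; suc; _+_; _*_; _∸_; _^_; _/_; _%_; _≤_; _<_; z≤n; s≤s; NonZero)
open import Data.Nat.DivMod
  using (_mod_; m%n<n; m≡m%n+[m/n]*n; [m+kn]%n≡m%n; +-distrib-/-∣ʳ; m*n/n≡m)
open import Data.Nat.Divisibility using (divides)
open import Data.Nat.Properties
open import Data.Nat.Solver using (module +-*-Solver)
open import Data.Product using (Σ; ∃; _×_; _,_; proj₁; proj₂; map₁)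
open import Data.Product.Properties using () renaming (≡-dec to ≡-decˣ)
open import Data.Sum using (_⊎_; inj₁; inj₂)
import Data.Sum as Sum
open import Data.Unit using (tt)
open import Function using (_∘_)
open import Level using (0ℓ)
open import Relation.Binary.Definitions using (DecidableEquality)
open import Relation.Binary.PropositionalEquality
open import Relation.Nullary using (Dec; yes; no; ¬_; ¬?)
open import Relation.Nullary.Decidable using (_×-dec_; _→-dec_; toWitness; map′)
open import Relation.Unary using (Pred; Decidable)

open +-*-Solver using (solve; _:+_; _:*_; _:=_; con)
open ≡-Reasoning

Seq : Set
Seq = ℕ → Gen

segment : Seq → ℕ → ℕ → Word
segment h s zero    = []
segment h s (suc n) = (h s , false) ∷ segment h (suc s) n

-- A record rather than a Π-type, so that the sequences and offsets of an agreement can be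
-- recovered from it by unification.
record Agree (h : Seq) (s : ℕ) (h′ : Seq) (s′ : ℕ) (n : ℕ) : Set where
  constructor agreeing
  field
    at : ∀ i → i < n → h (s + i) ≡ h′ (s′ + i)
open Agree

agree-≤ : ∀ {h s h′ s′ m n} → m ≤ n → Agree h s h′ s′ n → Agree h s h′ s′ m
agree-≤ m≤n agree = agreeing λ i i<m → at agree i (≤-trans i<m m≤n)

length-segment : ∀ h s n → length (segment h s n) ≡ n
length-segment h s zero    = refl
length-segment h s (suc n) = cong suc (length-segment h (suc s) n)

segment-++ : ∀ h s m n → segment h s m ++ segment h (s + m) n ≡ segment h s (m + n)
segment-++ h s zero    n = cong (λ t → segment h t n) (+-identityʳ s)
segment-++ h s (suc m) n = cong ((h s , false) ∷_) (begin
  segment h (suc s) m ++ segment h (s + suc m) n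
    ≡⟨ cong (λ t → segment h (suc s) m ++ segment h t n) (+-suc s m) ⟩
  segment h (suc s) m ++ segment h (suc s + m) n
    ≡⟨ segment-++ h (suc s) m n ⟩
  segment h (suc s) (m + n)
    ∎)

segment-cong : ∀ {h h′ s s′} n → Agree h s h′ s′ n → segment h s n ≡ segment h′ s′ n
segment-cong                    zero    agree = refl
segment-cong {h} {h′} {s} {s′} (suc n) agree = cong₂ _∷_
  (cong (_, false)
    (subst₂ (λ t t′ → h t ≡ h′ t′) (+-identityʳ s) (+-identityʳ s′) (at agree 0 (s≤s z≤n))))
  (segment-cong n (agreeing λ i i<n →
    subst₂ (λ t t′ → h t ≡ h′ t′) (+-suc s i) (+-suc s′ i) (at agree (suc i) (s≤s i<n))))

segment-injective : ∀ {h h′ s s′} n → segment h s n ≡ segment h′ s′ n → Agree h s h′ s′ n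
segment-injective                    zero    _  = agreeing λ _ ()
segment-injective {h} {h′} {s} {s′} (suc n) eq = agreeing λ where
  zero    _         → subst₂ (λ t t′ → h t ≡ h′ t′) (sym (+-identityʳ s)) (sym (+-identityʳ s′))
                        (cong proj₁ (proj₁ (∷-injective eq)))
  (suc i) (s≤s i<n) → subst₂ (λ t t′ → h t ≡ h′ t′) (sym (+-suc s i)) (sym (+-suc s′ i))
                        (at (segment-injective n (proj₂ (∷-injective eq))) i i<n)

segment-≡-++ : ∀ h s n u v → segment h s n ≡ u ++ v →
  u ≡ segment h s (length u) × v ≡ segment h (s + length u) (length v) × n ≡ length u + length v
segment-≡-++ h s n [] v refl =
  refl , cong₂ (segment h) (sym (+-identityʳ s)) (sym (length-segment h s n)) , sym (length-segment h s n)
segment-≡-++ h s (suc n) (a ∷ u) v eq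
  with a≡ , rest ← ∷-injective eq
  with u≡ , v≡ , n≡ ← segment-≡-++ h (suc s) n u v rest =
  cong₂ _∷_ (sym a≡) u≡ ,
  trans v≡ (cong (λ t → segment h t (length v)) (sym (+-suc s (length u)))) ,
  cong suc n≡

push-positive : ∀ g g′ w → push (g , false) ((g′ , false) ∷ w) ≡ (g , false) ∷ (g′ , false) ∷ w
push-positive gx gx w = refl
push-positive gx gy w = refl
push-positive gy gx w = refl
push-positive gy gy w = refl

reduce-segment : ∀ h s n → reduce (segment h s n) ≡ segment h s n
reduce-segment h s zero          = refl
reduce-segment h s (suc zero)    = refl
reduce-segment h s (suc (suc n)) rewrite reduce-segment h (suc s) (suc n) =
  push-positive (h s) (h (suc s)) (segment h (suc (suc s)) n)

invW-++ : ∀ u v → invW (u ++ v) ≡ invW v ++ invW u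
invW-++ u v = trans (cong reverse (map-++ invL u v)) (reverse-++ (map invL u) (map invL v))

invL-involutive : ∀ a → invL (invL a) ≡ a
invL-involutive (g , false) = refl
invL-involutive (g , true)  = refl

invW-involutive : ∀ u → invW (invW u) ≡ u
invW-involutive []      = refl
invW-involutive (a ∷ u) = begin
  invW (invW (a ∷ u))              ≡⟨ cong invW (invW-++ (a ∷ []) u) ⟩
  invW (invW u ++ invL a ∷ [])     ≡⟨ invW-++ (invW u) (invL a ∷ []) ⟩
  invL (invL a) ∷ invW (invW u)    ≡⟨ cong₂ _∷_ (invL-involutive a) (invW-involutive u) ⟩
  a ∷ u                            ∎

length-invW : ∀ u → length (invW u) ≡ length u
length-invW u = trans (length-reverse (map invL u)) (length-map invL u)

invW-≡-++ : ∀ p u v → invW p ≡ u ++ v → p ≡ invW v ++ invW u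
invW-≡-++ p u v eq = begin
  p                 ≡⟨ invW-involutive p ⟨
  invW (invW p)     ≡⟨ cong invW eq ⟩
  invW (u ++ v)     ≡⟨ invW-++ u v ⟩
  invW v ++ invW u  ∎

∈-segment⇒positive : ∀ {h s n a} → a ∈ segment h s n → proj₂ a ≡ false
∈-segment⇒positive {n = suc n} (here refl) = refl
∈-segment⇒positive {n = suc n} (there a∈) = ∈-segment⇒positive a∈

∈-invW-segment⇒negative : ∀ {h s n a} → a ∈ invW (segment h s n) → proj₂ a ≡ true
∈-invW-segment⇒negative {h} {s} {n} a∈
  with a′ , a′∈ , refl ← ∈-map⁻ invL (Any.reverse⁻ {xs = map invL (segment h s n)} a∈) =
  cong not (∈-segment⇒positive a′∈)

positive-negative-common-prefix : ∀ {h s n h′ s′ n′ b c d} →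
  segment h s n ≡ b ++ c → invW (segment h′ s′ n′) ≡ b ++ d → b ≡ []
positive-negative-common-prefix {b = []}    _  _ = refl
positive-negative-common-prefix {n = suc n} {h′} {s′} {n′} {b = a ∷ b} eq eq′
  with refl , _ ← ∷-injective eq
  with () ← ∈-invW-segment⇒negative {h′} {s′} {n′} (subst (a ∈_) (sym eq′) (here refl))

Periodic : ℕ → Seq → Set
Periodic P h = ∀ i → h (P + i) ≡ h i

periodic-* : ∀ {P h} → Periodic P h → ∀ k → Periodic (k * P) h
periodic-*             per zero    i = refl
periodic-* {P} {h} per (suc k) i = begin
  h (P + k * P + i)    ≡⟨ cong h (+-assoc P (k * P) i) ⟩
  h (P + (k * P + i))  ≡⟨ per (k * P + i) ⟩
  h (k * P + i)        ≡⟨ periodic-* per k i ⟩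
  h i                  ∎

agree-period-extend : ∀ {P h h′ s s′} .{{_ : NonZero P}} → Periodic P h → Periodic P h′ →
  Agree h s h′ s′ P → ∀ i → h (s + i) ≡ h′ (s′ + i)
agree-period-extend {P} {h} {h′} {s} {s′} per per′ agree i = begin
  h (s + i)                      ≡⟨ cong h (unwind s) ⟩
  h (i / P * P + (s + i % P))    ≡⟨ periodic-* per (i / P) (s + i % P) ⟩
  h (s + i % P)                  ≡⟨ at agree (i % P) (m%n<n i P) ⟩
  h′ (s′ + i % P)                ≡⟨ periodic-* per′ (i / P) (s′ + i % P) ⟨
  h′ (i / P * P + (s′ + i % P))  ≡⟨ cong h′ (unwind s′) ⟨
  h′ (s′ + i)                    ∎
  where
  unwind : ∀ t → t + i ≡ i / P * P + (t + i % P)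
  unwind t = trans (cong (t +_) (m≡m%n+[m/n]*n i P))
    (solve 4 (λ t r q p → t :+ (r :+ q :* p) := q :* p :+ (t :+ r)) refl t (i % P) (i / P) P)

agree-shift-back : ∀ {P h h′ s s′} c .{{_ : NonZero P}} → Periodic P h → Periodic P h′ →
  (∀ i → h (s + c + i) ≡ h′ (s′ + c + i)) → ∀ i → h (s + i) ≡ h′ (s′ + i)
agree-shift-back {P} {h} {h′} {s} {s′} c per per′ agree i = begin
  h (s + i)                       ≡⟨ periodic-* per c (s + i) ⟨
  h (c * P + (s + i))             ≡⟨ cong h (wind s) ⟩
  h (s + c + (c * P ∸ c + i))     ≡⟨ agree (c * P ∸ c + i) ⟩
  h′ (s′ + c + (c * P ∸ c + i))   ≡⟨ cong h′ (wind s′) ⟨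
  h′ (c * P + (s′ + i))           ≡⟨ periodic-* per′ c (s′ + i) ⟩
  h′ (s′ + i)                     ∎
  where
  wind : ∀ t → c * P + (t + i) ≡ t + c + (c * P ∸ c + i)
  wind t = trans (cong (_+ (t + i)) (sym (m+[n∸m]≡n (m≤m*n c P))))
    (solve 4 (λ c d t i → c :+ d :+ (t :+ i) := t :+ c :+ (d :+ i)) refl c (c * P ∸ c) t i)

segment-swap : ∀ {h} s m n → Periodic (m + n) h →
  segment h (s + m) n ++ segment h s m ≡ segment h (s + m) (n + m)
segment-swap {h} s m n per = begin
  segment h (s + m) n ++ segment h s m
    ≡⟨ cong (segment h (s + m) n ++_) (segment-cong m (agreeing λ i _ → wrap i)) ⟩
  segment h (s + m) n ++ segment h (s + m + n) m
    ≡⟨ segment-++ h (s + m) n m ⟩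
  segment h (s + m) (n + m)
    ∎
  where
  wrap : ∀ i → h (s + i) ≡ h (s + m + n + i)
  wrap i = sym (trans
    (cong h (solve 4 (λ s m n i → s :+ m :+ n :+ i := (m :+ n) :+ (s :+ i)) refl s m n i))
    (per (s + i)))

rotate-segment : ∀ {M h} s → Periodic M h → ∀ u v →
  segment h s M ≡ u ++ v → v ++ u ≡ segment h (s + length u) M
rotate-segment {h = h} s per u v eq
  with u≡ , v≡ , refl ← segment-≡-++ h s _ u v eq = begin
  v ++ u
    ≡⟨ cong₂ _++_ v≡ u≡ ⟩
  segment h (s + length u) (length v) ++ segment h s (length u)
    ≡⟨ segment-swap s (length u) (length v) per ⟩
  segment h (s + length u) (length v + length u)
    ≡⟨ cong (segment h (s + length u)) (+-comm (length v) (length u)) ⟩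
  segment h (s + length u) (length u + length v)
    ∎

pow-segment : ∀ {N h} → Periodic N h → ∀ n → pow (segment h 0 N) n ≡ segment h 0 (n * N)
pow-segment             per zero    = refl
pow-segment {N} {h} per (suc n) = begin
  reduce (segment h 0 N ++ pow (segment h 0 N) n)
    ≡⟨ cong (λ w → reduce (segment h 0 N ++ w)) (pow-segment per n) ⟩
  reduce (segment h 0 N ++ segment h 0 (n * N))
    ≡⟨ cong (λ w → reduce (segment h 0 N ++ w)) (segment-cong (n * N) (agreeing λ i _ → sym (per i))) ⟩
  reduce (segment h 0 N ++ segment h N (n * N))
    ≡⟨ cong reduce (segment-++ h 0 N (n * N)) ⟩
  reduce (segment h 0 (N + n * N))
    ≡⟨ reduce-segment h 0 (N + n * N) ⟩
  segment h 0 (N + n * N)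
    ∎

neg : Gen → Gen
neg gx = gy
neg gy = gx

blockLetter : Bool → Gen → ℕ → Gen
blockLetter false a 5 = neg a
blockLetter false a _ = a
blockLetter true  a 2 = neg a
blockLetter true  a 4 = neg a
blockLetter true  a _ = a

img-segment : ∀ b a → img b a ≡ segment (blockLetter b a) 0 6
img-segment false gx = refl
img-segment false gy = refl
img-segment true  gx = refl
img-segment true  gy = refl

blockEnd-injective : ∀ b {a a′} → blockLetter b a 5 ≡ blockLetter b a′ 5 → a ≡ a′
blockEnd-injective false {gx} {gx} _ = refl
blockEnd-injective false {gy} {gy} _ = refl
blockEnd-injective true  eq = eq

substitute : Bool → Seq → Seq
substitute b h i = blockLetter b (h (i / 6)) (i % 6)

substitute-shift : ∀ b h i k → substitute b h (i + k * 6) ≡ substitute b (λ j → h (j + k)) i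
substitute-shift b h i k = cong₂ (λ q r → blockLetter b (h q) r)
  (trans (+-distrib-/-∣ʳ i (divides k refl)) (cong (i / 6 +_) (m*n/n≡m k 6)))
  ([m+kn]%n≡m%n i k 6)

segment-substitute-shift : ∀ b h t k n →
  segment (substitute b h) (t + k * 6) n ≡ segment (substitute b (λ j → h (j + k))) t n
segment-substitute-shift b h t k n = segment-cong n (agreeing λ i _ → trans
  (cong (substitute b h) (solve 3 (λ t k i → t :+ k :* con 6 :+ i := t :+ i :+ k :* con 6) refl t k i))
  (substitute-shift b h (t + i) k))

periodic-substitute : ∀ {P h} b → Periodic P h → Periodic (6 * P) (substitute b h)
periodic-substitute {P} {h} b per i = begin
  substitute b h (6 * P + i)
    ≡⟨ cong (substitute b h) (trans (+-comm (6 * P) i) (cong (i +_) (*-comm 6 P))) ⟩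
  substitute b h (i + P * 6)
    ≡⟨ substitute-shift b h i P ⟩
  blockLetter b (h (i / 6 + P)) (i % 6)
    ≡⟨ cong (λ q → blockLetter b (h q) (i % 6)) (+-comm (i / 6) P) ⟩
  blockLetter b (h (P + i / 6)) (i % 6)
    ≡⟨ cong (λ a → blockLetter b a (i % 6)) (per (i / 6)) ⟩
  substitute b h i
    ∎

concatMap-segment : ∀ b h s n →
  concatMap (imgL b) (segment h s n) ≡ segment (substitute b h) (s * 6) (n * 6)
concatMap-segment b h s zero    = refl
concatMap-segment b h s (suc n) = begin
  img b (h s) ++ concatMap (imgL b) (segment h (suc s) n)
    ≡⟨ cong₂ _++_ block (concatMap-segment b h (suc s) n) ⟩
  segment H (s * 6) 6 ++ segment H (6 + s * 6) (n * 6)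
    ≡⟨ cong (λ t → segment H (s * 6) 6 ++ segment H t (n * 6)) (+-comm 6 (s * 6)) ⟩
  segment H (s * 6) 6 ++ segment H (s * 6 + 6) (n * 6)
    ≡⟨ segment-++ H (s * 6) 6 (n * 6) ⟩
  segment H (s * 6) (6 + n * 6)
    ∎
  where
  H = substitute b h
  block : img b (h s) ≡ segment H (s * 6) 6
  block = trans (img-segment b (h s)) (sym (segment-substitute-shift b h 0 s 6))

letters : List Bool → Gen → Seq
letters []      g _ = g
letters (b ∷ w) g   = substitute b (letters w g)

periodic-letters : ∀ w g → Periodic (6 ^ length w) (letters w g)
periodic-letters []      g i = refl
periodic-letters (b ∷ w) g   = periodic-substitute b (periodic-letters w g)

fw-segment : ∀ w g → fw w ((g , false) ∷ []) ≡ segment (letters w g) 0 (6 ^ length w)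
fw-segment []      g = refl
fw-segment (b ∷ w) g = begin
  reduce (concatMap (imgL b) (fw w ((g , false) ∷ [])))
    ≡⟨ cong (reduce ∘ concatMap (imgL b)) (fw-segment w g) ⟩
  reduce (concatMap (imgL b) (segment (letters w g) 0 P))
    ≡⟨ cong reduce (concatMap-segment b (letters w g) 0 P) ⟩
  reduce (segment (letters (b ∷ w) g) 0 (P * 6))
    ≡⟨ reduce-segment (letters (b ∷ w) g) 0 (P * 6) ⟩
  segment (letters (b ∷ w) g) 0 (P * 6)
    ≡⟨ cong (segment (letters (b ∷ w) g) 0) (*-comm P 6) ⟩
  segment (letters (b ∷ w) g) 0 (6 * P)
    ∎
  where
  P = 6 ^ length w

pair : Gen → Gen → Seq
pair a₀ a₁ zero    = a₀
pair a₀ a₁ (suc _) = a₁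

window : Bool → Fin 6 → Gen → Gen → Word
window b t a₀ a₁ = segment (substitute b (pair a₀ a₁)) (toℕ t) 7

window-two-blocks : ∀ b t h → segment (substitute b h) (toℕ t) 7 ≡ window b t (h 0) (h 1)
window-two-blocks b 0F h = refl
window-two-blocks b 1F h = refl
window-two-blocks b 2F h = refl
window-two-blocks b 3F h = refl
window-two-blocks b 4F h = refl
window-two-blocks b 5F h = refl

_≟ᴳ_ : DecidableEquality Gen
gx ≟ᴳ gx = yes refl
gx ≟ᴳ gy = no λ ()
gy ≟ᴳ gx = no λ ()
gy ≟ᴳ gy = yes refl

_≟ᵂ_ : DecidableEquality Word
_≟ᵂ_ = ≡-decᴸ (≡-decˣ _≟ᴳ_ _≟ᴮ_)

∀-Bool? : ∀ {P : Pred Bool 0ℓ} → Decidable P → Dec (∀ b → P b)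
∀-Bool? P? = map′ (λ (p , q) → λ { false → p ; true → q }) (λ p → p false , p true)
  (P? false ×-dec P? true)

∀-Gen? : ∀ {P : Pred Gen 0ℓ} → Decidable P → Dec (∀ g → P g)
∀-Gen? P? = map′ (λ (p , q) → λ { gx → p ; gy → q }) (λ p → p gx , p gy)
  (P? gx ×-dec P? gy)

-- Both facts are decided by evaluating a decision procedure over all windows; they are opaque
-- so that unification never unfolds it.
opaque
  window-recognizes : ∀ b t a₀ a₁ b′ t′ a₀′ a₁′ →
    window b t a₀ a₁ ≡ window b′ t′ a₀′ a₁′ → b ≡ b′ × t ≡ t′
  window-recognizes = toWitness {a? =
    ∀-Bool? λ b → all? λ t → ∀-Gen? λ a₀ → ∀-Gen? λ a₁ →
    ∀-Bool? λ b′ → all? λ t′ → ∀-Gen? λ a₀′ → ∀-Gen? λ a₁′ →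
    (window b t a₀ a₁ ≟ᵂ window b′ t′ a₀′ a₁′) →-dec ((b ≟ᴮ b′) ×-dec (t ≟ᶠ t′))} tt

  window-nonconstant : ∀ b t a₀ a₁ g → ¬ window b t a₀ a₁ ≡ segment (λ _ → g) 0 7
  window-nonconstant = toWitness {a? =
    ∀-Bool? λ b → all? λ t → ∀-Gen? λ a₀ → ∀-Gen? λ a₁ → ∀-Gen? λ g →
    ¬? (window b t a₀ a₁ ≟ᵂ segment (λ _ → g) 0 7)} tt

substitute-window : ∀ b h s →
  segment (substitute b h) s 7 ≡ window b (s mod 6) (h (s / 6)) (h (suc (s / 6)))
substitute-window b h s = begin
  segment (substitute b h) s 7
    ≡⟨ cong (λ t → segment (substitute b h) t 7) s≡ ⟩
  segment (substitute b h) (toℕ (s mod 6) + s / 6 * 6) 7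
    ≡⟨ segment-substitute-shift b h (toℕ (s mod 6)) (s / 6) 7 ⟩
  segment (substitute b (λ j → h (j + s / 6))) (toℕ (s mod 6)) 7
    ≡⟨ window-two-blocks b (s mod 6) (λ j → h (j + s / 6)) ⟩
  window b (s mod 6) (h (s / 6)) (h (suc (s / 6)))
    ∎
  where
  s≡ : s ≡ toℕ (s mod 6) + s / 6 * 6
  s≡ = trans (m≡m%n+[m/n]*n s 6) (cong (_+ s / 6 * 6) (sym (toℕ-fromℕ< (m%n<n s 6))))

substitute-recognizes : ∀ b b′ {h h′ s s′} → Agree (substitute b h) s (substitute b′ h′) s′ 7 →
  b ≡ b′ × s % 6 ≡ s′ % 6
substitute-recognizes b b′ {h} {h′} {s} {s′} agree = proj₁ recognized , phase (proj₂ recognized)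
  where
  recognized : b ≡ b′ × s mod 6 ≡ s′ mod 6
  recognized = window-recognizes
    b (s mod 6) (h (s / 6)) (h (suc (s / 6))) b′ (s′ mod 6) (h′ (s′ / 6)) (h′ (suc (s′ / 6)))
    (trans (sym (substitute-window b h s)) (trans (segment-cong 7 agree) (substitute-window b′ h′ s′)))
  phase : s mod 6 ≡ s′ mod 6 → s % 6 ≡ s′ % 6
  phase eq = trans (sym (toℕ-fromℕ< (m%n<n s 6))) (trans (cong toℕ eq) (toℕ-fromℕ< (m%n<n s′ 6)))

substitute-nonconstant : ∀ b h s g → ¬ segment (substitute b h) s 7 ≡ segment (λ _ → g) 0 7
substitute-nonconstant b h s g eq = window-nonconstant b (s mod 6) (h (s / 6)) (h (suc (s / 6))) g
  (trans (sym (substitute-window b h s)) eq)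

substitute-blockEnd : ∀ b h s k →
  substitute b h (s + (5 ∸ s % 6 + k * 6)) ≡ blockLetter b (h (s / 6 + k)) 5
substitute-blockEnd b h s k = trans (cong (substitute b h) position) (substitute-shift b h 5 (s / 6 + k))
  where
  position : s + (5 ∸ s % 6 + k * 6) ≡ 5 + (s / 6 + k) * 6
  position = begin
    s + (5 ∸ s % 6 + k * 6)
      ≡⟨ cong (_+ (5 ∸ s % 6 + k * 6)) (m≡m%n+[m/n]*n s 6) ⟩
    s % 6 + s / 6 * 6 + (5 ∸ s % 6 + k * 6)
      ≡⟨ solve 4 (λ r q d k → r :+ q :* con 6 :+ (d :+ k :* con 6) := r :+ d :+ (q :+ k) :* con 6)
           refl (s % 6) (s / 6) (5 ∸ s % 6) k ⟩
    s % 6 + (5 ∸ s % 6) + (s / 6 + k) * 6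
      ≡⟨ cong (_+ (s / 6 + k) * 6) (m+[n∸m]≡n (≤-pred (m%n<n s 6))) ⟩
    5 + (s / 6 + k) * 6
      ∎

agree-desubstitute : ∀ b {h h′ s s′} n → s % 6 ≡ s′ % 6 →
  Agree (substitute b h) s (substitute b h′) s′ (n * 6) → Agree h (s / 6) h′ (s′ / 6) n
agree-desubstitute b {h} {h′} {s} {s′} n phase agree = agreeing λ k k<n → blockEnd-injective b (begin
  blockLetter b (h (s / 6 + k)) 5
    ≡⟨ substitute-blockEnd b h s k ⟨
  substitute b h (s + (5 ∸ s % 6 + k * 6))
    ≡⟨ at agree (5 ∸ s % 6 + k * 6) (offset<n*6 k<n) ⟩
  substitute b h′ (s′ + (5 ∸ s % 6 + k * 6))
    ≡⟨ cong (λ r → substitute b h′ (s′ + (5 ∸ r + k * 6))) phase ⟩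
  substitute b h′ (s′ + (5 ∸ s′ % 6 + k * 6))
    ≡⟨ substitute-blockEnd b h′ s′ k ⟩
  blockLetter b (h′ (s′ / 6 + k)) 5
    ∎)
  where
  offset<n*6 : ∀ {k} → k < n → 5 ∸ s % 6 + k * 6 < n * 6
  offset<n*6 {k} k<n = ≤-trans (s≤s (+-monoˡ-≤ (k * 6) (m∸n≤m 5 (s % 6)))) (*-monoˡ-≤ 6 k<n)

7≤7*6^n : ∀ n → 7 ≤ 7 * 6 ^ n
7≤7*6^n n = *-monoʳ-≤ 7 (m^n>0 6 n)

7*6^n*6≡7*6^[1+n] : ∀ n → 7 * 6 ^ n * 6 ≡ 7 * 6 ^ suc n
7*6^n*6≡7*6^[1+n] n = trans (*-assoc 7 (6 ^ n) 6) (cong (7 *_) (*-comm (6 ^ n) 6))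

rigidity : ∀ w w′ g g′ {s s′} → Agree (letters w g) s (letters w′ g′) s′ (7 * 6 ^ length w) →
  w ≡ w′ × g ≡ g′
rigidity []        []         g g′ agree = refl , at agree 0 (s≤s z≤n)
rigidity []        (b′ ∷ w′) g g′ {s′ = s′} agree =
  ⊥-elim (substitute-nonconstant b′ (letters w′ g′) s′ g (sym (segment-cong 7 agree)))
rigidity (b ∷ w)  []         g g′ {s} agree = ⊥-elim (substitute-nonconstant b (letters w g) s g′
  (segment-cong 7 (agree-≤ (7≤7*6^n (suc (length w))) agree)))
rigidity (b ∷ w)  (b′ ∷ w′) g g′ {s} {s′} agree = descend
  (substitute-recognizes b b′ {letters w g} {letters w′ g′} (agree-≤ (7≤7*6^n (suc (length w))) agree))
  where
  descend : b ≡ b′ × s % 6 ≡ s′ % 6 → b ∷ w ≡ b′ ∷ w′ × g ≡ g′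
  descend (refl , phase) = map₁ (cong (b ∷_)) (rigidity w w′ g g′
    (agree-desubstitute b {letters w g} {letters w′ g′} (7 * 6 ^ length w) phase
      (agree-≤ (≤-reflexive (7*6^n*6≡7*6^[1+n] (length w))) agree)))

data Exponent (T : Tree) (w : List Bool) : Gen → ℕ → Set where
  member-x    : mem T w → Exponent T w gx 59
  member-y    : mem T w → Exponent T w gy 61
  nonmember-x : ¬ mem T w → Exponent T w gx 67
  nonmember-y : ¬ mem T w → Exponent T w gy 71

exponent-unique : ∀ {T w g n n′} → Exponent T w g n → Exponent T w g n′ → n ≡ n′
exponent-unique (member-x _)    (member-x _)    = refl
exponent-unique (member-y _)    (member-y _)    = refl
exponent-unique (nonmember-x _) (nonmember-x _) = refl
exponent-unique (nonmember-y _) (nonmember-y _) = refl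
exponent-unique (member-x m)    (nonmember-x m̸) = ⊥-elim (m̸ m)
exponent-unique (member-y m)    (nonmember-y m̸) = ⊥-elim (m̸ m)
exponent-unique (nonmember-x m̸) (member-x m)    = ⊥-elim (m̸ m)
exponent-unique (nonmember-y m̸) (member-y m)    = ⊥-elim (m̸ m)

59≤exponent : ∀ {T w g n} → Exponent T w g n → 59 ≤ n
59≤exponent (member-x _)    = ≤-refl
59≤exponent (member-y _)    = m≤m+n 59 2
59≤exponent (nonmember-x _) = m≤m+n 59 8
59≤exponent (nonmember-y _) = m≤m+n 59 12

relator-segment : ∀ w g n →
  pow (fw w ((g , false) ∷ [])) n ≡ segment (letters w g) 0 (n * 6 ^ length w)
relator-segment w g n =
  trans (cong (λ u → pow u n) (fw-segment w g)) (pow-segment (periodic-letters w g) n)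

isRelator-segment : ∀ {T ρ} → IsRelator T ρ →
  ∃ λ w → ∃ λ g → ∃ λ n → Exponent T w g n × ρ ≡ segment (letters w g) 0 (n * 6 ^ length w)
isRelator-segment (w , inj₁ (m , eq)) =
  w , gx , 59 , member-x m , trans eq (relator-segment w gx 59)
isRelator-segment (w , inj₂ (inj₁ (m , eq))) =
  w , gy , 61 , member-y m , trans eq (relator-segment w gy 61)
isRelator-segment (w , inj₂ (inj₂ (inj₁ (m̸ , eq)))) =
  w , gx , 67 , nonmember-x m̸ , trans eq (relator-segment w gx 67)
isRelator-segment (w , inj₂ (inj₂ (inj₂ (m̸ , eq)))) =
  w , gy , 71 , nonmember-y m̸ , trans eq (relator-segment w gy 71)

record CyclicRelator (T : Tree) : Set where
  constructor cyclicRelator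
  field
    word       : List Bool
    generator  : Gen
    exponent   : ℕ
    shift      : ℕ
    isExponent : Exponent T word generator exponent

  sequence : Seq
  sequence = letters word generator

  period : ℕ
  period = exponent * 6 ^ length word

  positive : Word
  positive = segment sequence shift period
open CyclicRelator

Presents : ∀ {T} → CyclicRelator T → Word → Set
Presents c r = r ≡ positive c ⊎ r ≡ invW (positive c)

symmetrized-relator : ∀ {T r} → RT T r → Σ (CyclicRelator T) λ c → Presents c r
symmetrized-relator (ρ , isRel , u , v , ρ≡uv , r≡)
  with w , g , n , e , refl ← isRelator-segment isRel =
  cyclicRelator w g n (length u) e ,
  Sum.map (λ r≡vu → trans r≡vu rotated) (λ r≡vu⁻¹ → trans r≡vu⁻¹ (cong invW rotated)) r≡
  where
  rotated : v ++ u ≡ segment (letters w g) (length u) (n * 6 ^ length w)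
  rotated = rotate-segment 0 (periodic-* (periodic-letters w g) n) u v ρ≡uv

common-subword-agree : ∀ {h s n h′ s′ n′} u b v u′ v′ →
  segment h s n ≡ u ++ b ++ v → segment h′ s′ n′ ≡ u′ ++ b ++ v′ →
  Agree h (s + length u) h′ (s′ + length u′) (length b)
common-subword-agree {h} {s} {n} {h′} {s′} {n′} u b v u′ v′ eq eq′ =
  segment-injective (length b) (trans (sym (middle h s n u v eq)) (middle h′ s′ n′ u′ v′ eq′))
  where
  middle : ∀ h s n u v → segment h s n ≡ u ++ b ++ v → b ≡ segment h (s + length u) (length b)
  middle h s n u v eq
    with _ , rest , _ ← segment-≡-++ h s n u (b ++ v) eq
    with b≡ , _ ← segment-≡-++ h (s + length u) _ b v (sym rest) = b≡

periodic-segment-≡ : ∀ {P h} .{{_ : NonZero P}} → Periodic P h → ∀ s s′ c M →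
  Agree h (s + c) h (s′ + c) P → segment h s M ≡ segment h s′ M
periodic-segment-≡ per s s′ c M agree =
  segment-cong M (agreeing λ i _ → agree-shift-back c per per (agree-period-extend per per agree) i)

relator-rigidity : ∀ {T w g n w′ g′ n′ s s′} → Exponent T w g n → Exponent T w′ g′ n′ →
  Agree (letters w g) s (letters w′ g′) s′ (7 * 6 ^ length w) → w ≡ w′ × g ≡ g′ × n ≡ n′
relator-rigidity {w = w} {g} {n} {w′} {g′} {n′} e e′ agree = conclude (rigidity w w′ g g′ agree)
  where
  conclude : w ≡ w′ × g ≡ g′ → w ≡ w′ × g ≡ g′ × n ≡ n′
  conclude (refl , refl) = refl , refl , exponent-unique e e′

long-common-prefix : ∀ {T b u u′} (c c′ : CyclicRelator T) →
  positive c ≡ b ++ u → positive c′ ≡ b ++ u′ → 7 * 6 ^ length (word c) ≤ length b →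
  positive c ≡ positive c′
long-common-prefix {b = b} {u} {u′} (cyclicRelator w g n S e) (cyclicRelator w′ g′ n′ S′ e′)
  eq eq′ long =
  conclude (relator-rigidity e e′ (agree-≤ long common))
  where
  common : Agree (letters w g) (S + 0) (letters w′ g′) (S′ + 0) (length b)
  common = common-subword-agree [] b u [] u′ eq eq′
  conclude : w ≡ w′ × g ≡ g′ × n ≡ n′ →
    segment (letters w g) S (n * 6 ^ length w) ≡ segment (letters w′ g′) S′ (n′ * 6 ^ length w′)
  conclude (refl , refl , refl) =
    periodic-segment-≡ {{m^n≢0 6 (length w)}} (periodic-letters w g) S S′ 0 _
      (agree-≤ (≤-trans (m≤n*m (6 ^ length w) 7) long) common)

long-common-suffix : ∀ {T u b u′} (c c′ : CyclicRelator T) →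
  positive c ≡ u ++ b → positive c′ ≡ u′ ++ b → 7 * 6 ^ length (word c) ≤ length b →
  positive c ≡ positive c′
long-common-suffix {u = u} {b} {u′} (cyclicRelator w g n S e) (cyclicRelator w′ g′ n′ S′ e′)
  eq eq′ long =
  conclude (relator-rigidity e e′ (agree-≤ long common))
  where
  common : Agree (letters w g) (S + length u) (letters w′ g′) (S′ + length u′) (length b)
  common = common-subword-agree u b [] u′ []
    (trans eq (cong (u ++_) (sym (++-identityʳ b)))) (trans eq′ (cong (u′ ++_) (sym (++-identityʳ b))))
  conclude : w ≡ w′ × g ≡ g′ × n ≡ n′ →
    segment (letters w g) S (n * 6 ^ length w) ≡ segment (letters w′ g′) S′ (n′ * 6 ^ length w′)
  conclude (refl , refl , refl) =
    periodic-segment-≡ {{m^n≢0 6 (length w)}} (periodic-letters w g) S S′ (length u) _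
      (subst (λ t → Agree (letters w g) (S + length u) (letters w g) (S′ + t) (6 ^ length w))
        (sym same-offset) (agree-≤ (≤-trans (m≤n*m (6 ^ length w) 7) long) common))
    where
    same-offset : length u ≡ length u′
    same-offset = +-cancelʳ-≡ (length b) (length u) (length u′) (trans
      (sym (proj₂ (proj₂ (segment-≡-++ _ S _ u b eq))))
      (proj₂ (proj₂ (segment-≡-++ _ S′ _ u′ b eq′))))

long-piece-spans-7-periods : ∀ {n P m} → 59 ≤ n → n * P ≤ 8 * m → 7 * P ≤ m
long-piece-spans-7-periods {n} {P} 59≤n nP≤8m = *-cancelˡ-≤ 8
  (≤-trans (≤-reflexive (sym (*-assoc 8 7 P)))
  (≤-trans (*-monoˡ-≤ P (m≤m+n 56 3))
  (≤-trans (*-monoˡ-≤ P 59≤n) nP≤8m)))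

length-presented : ∀ {T r} (c : CyclicRelator T) → Presents c r → length r ≡ period c
length-presented c (inj₁ refl) = length-segment _ _ _
length-presented c (inj₂ refl) = trans (length-invW (positive c)) (length-segment _ _ _)

short-piece : ∀ {T r} (c : CyclicRelator T) (b : Word) → Presents c r →
  ¬ 7 * 6 ^ length (word c) ≤ length b → 8 * length b < length r
short-piece {r = r} c b presents not-long with 8 * length b <? length r
... | yes short = short
... | no  ¬short = ⊥-elim (not-long (long-piece-spans-7-periods (59≤exponent (isExponent c))
                     (subst (_≤ 8 * length b) (length-presented c presents) (≮⇒≥ ¬short))))

empty-piece-short : ∀ {b : Word} k → b ≡ [] → ¬ 7 * 6 ^ k ≤ length b
empty-piece-short k refl long with () ← ≤-trans (7≤7*6^n k) long

no-long-common-prefix : ∀ {T r r′ b u u′} (c c′ : CyclicRelator T) →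
  Presents c r → Presents c′ r′ →
  r ≢ r′ → r ≡ b ++ u → r′ ≡ b ++ u′ → ¬ 7 * 6 ^ length (word c) ≤ length b
no-long-common-prefix {b = b} c c′ (inj₁ refl) (inj₁ refl) r≢r′ eq eq′ long =
  r≢r′ (long-common-prefix {b = b} c c′ eq eq′ long)
no-long-common-prefix {b = b} {u} {u′} c c′ (inj₂ refl) (inj₂ refl) r≢r′ eq eq′ long =
  r≢r′ (cong invW (long-common-suffix {u = invW u} {invW b} {invW u′} c c′
    (invW-≡-++ (positive c) b u eq) (invW-≡-++ (positive c′) b u′ eq′)
    (subst (_ ≤_) (sym (length-invW b)) long)))
no-long-common-prefix {b = b} c c′ (inj₁ refl) (inj₂ refl) _ eq eq′ =
  empty-piece-short (length (word c))
    (positive-negative-common-prefix {h′ = sequence c′} {shift c′} {period c′} {b = b} eq eq′)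
no-long-common-prefix {b = b} c c′ (inj₂ refl) (inj₁ refl) _ eq eq′ =
  empty-piece-short (length (word c))
    (positive-negative-common-prefix {h′ = sequence c} {shift c} {period c} {b = b} eq′ eq)

lemma6p5 : (T : Tree) → C′-inv 8 (RT T)
lemma6p5 T r r′ Rr Rr′ r≢r′ b c d r≡bc r′≡bd =
  let ρ  , presents  = symmetrized-relator {T} Rr
      ρ′ , presents′ = symmetrized-relator {T} Rr′
  in  short-piece ρ b presents
        (no-long-common-prefix {b = b} {c} {d} ρ ρ′ presents presents′ r≢r′ r≡bc r′≡bd)
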